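{- A meandering diagram is a meandering tree if and only if it has no flawed pair, i.e. no pair consisting of a lower arc with ends $x_\ell<x_r$ and an upper arc with ends $x'_\ell<x'_r$ such that $x'_\ell<x_\ell<x'_r<x_r$.
   Context: A meandering diagram of size $n$ is a non-crossing arc-diagram on the points $0,\tfrac12,1,\dots,n-\tfrac12,n$ of the horizontal axis, integer points black and half-integer points white, all arcs being semicircles in the upper half-plane (upper arcs) or in the lower half-plane (lower arcs), every upper arc having a black left end and a white right end, every lower arc having a white left end and a black right end, and every white point being incident to exactly one upper arc and exactly one lower arc. Its underlying graph has the black points as vertices and, for each white point, an edge joining the black ends of its upper and lower arcs. A meandering tree is a meandering diagram whose underlying graph is a tree. -}

module Defs where

open import Data.Nat using (ℕ; zero; suc; _+_; _*_; _≤_; _<_)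
open import Data.Fin using (Fin; toℕ)
open import Data.Product using (Σ; _×_; _,_; ∃-syntax)
open import Data.Sum using (_⊎_)
open import Data.Empty using (⊥)
open import Data.List using (List; []; _∷_)
open import Data.List.Relation.Unary.Unique.Propositional using (Unique)
open import Relation.Binary.PropositionalEquality using (_≡_)
open import Relation.Nullary using (¬_)

-- Coordinates are DOUBLED: the point x ∈ {0, 1/2, ..., n} is represented by
-- the natural number 2x ∈ {0, 1, ..., 2n}.  Black points are even, white odd.
-- The white point i + 1/2 (i : Fin n) has doubled coordinate 2i+1.

Arc : Set
Arc = ℕ × ℕ

Crosses : Arc → Arc → Set
Crosses (a , b) (c , d) = a < c × c < b × b < d

-- Every upper arc has a white right end and
-- every white point has exactly one upper arc, so upper arcs are indexed by the
-- white points i : Fin n; `up i` is the (integer) black left end of the upper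
-- arc ending at i + 1/2.  Likewise `down i` is the black right end of the
-- unique lower arc whose white left end is i + 1/2.
record MeanderingDiagram (n : ℕ) : Set where
  field
    up     : Fin n → ℕ
    down   : Fin n → ℕ
    up≤    : ∀ i → up i ≤ toℕ i
    <down  : ∀ i → toℕ i < down i
    down≤n : ∀ i → down i ≤ n

  upperArc : Fin n → Arc
  upperArc i = (2 * up i , 2 * toℕ i + 1)

  lowerArc : Fin n → Arc
  lowerArc i = (2 * toℕ i + 1 , 2 * down i)

  field
    upper-noncrossing : ∀ i j → ¬ Crosses (upperArc i) (upperArc j)
    lower-noncrossing : ∀ i j → ¬ Crosses (lowerArc i) (lowerArc j)

open MeanderingDiagram public

module _ {n : ℕ} (D : MeanderingDiagram n) where

  -- Underlying (multi)graph: vertices are the black points 0..n, and the white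
  -- point i+1/2 gives an edge i joining up i and down i.
  Joins : Fin n → ℕ → ℕ → Set
  Joins e u v = (up D e ≡ u × down D e ≡ v) ⊎ (down D e ≡ u × up D e ≡ v)

  data Walk : ℕ → ℕ → Set where
    nil  : ∀ {v} → Walk v v
    cons : ∀ {u w v} (e : Fin n) → Joins e u w → Walk w v → Walk u v

  walkEdges : ∀ {u v} → Walk u v → List (Fin n)
  walkEdges nil            = []
  walkEdges (cons e _ w)   = e ∷ walkEdges w

  -- vertices visited after the starting vertex
  walkVertices : ∀ {u v} → Walk u v → List ℕ
  walkVertices nil                        = []
  walkVertices (cons {w = x} e _ w)       = x ∷ walkVertices w

  Connected : Set
  Connected = ∀ u v → u ≤ n → v ≤ n → Walk u v

  -- A cycle: a nonempty closed walk with pairwise distinct edges and pairwise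
  -- distinct vertices (the start vertex counted once, as the final vertex).
  IsCycle : ∀ {v} → Walk v v → Set
  IsCycle nil = ⊥
  IsCycle w@(cons _ _ _) = Unique (walkEdges w) × Unique (walkVertices w)

  HasCycle : Set
  HasCycle = ∃[ v ] Σ (Walk v v) IsCycle

  IsMeanderingTree : Set
  IsMeanderingTree = Connected × ¬ HasCycle

  FlawedPair : Fin n → Fin n → Set
  FlawedPair j i =
    let (xℓ , xr) = lowerArc D j ; (x'ℓ , x'r) = upperArc D i
    in x'ℓ < xℓ × xℓ < x'r × x'r < xr

  HasFlawedPair : Set
  HasFlawedPair = ∃[ j ] ∃[ i ] FlawedPair j i

module Submission where

open import Defs
open import Data.Nat using (ℕ; zero; suc; _+_; _*_; _≤_; _<_; _≤′_; ≤′-refl; ≤′-step; z≤n; s≤s; _≤?_)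
open import Data.Nat.Properties
open import Data.Fin using (Fin; toℕ; fromℕ<)
open import Data.Fin.Properties using (toℕ-injective; toℕ<n; toℕ-fromℕ<)
open import Data.Product using (Σ; _×_; _,_; proj₁; proj₂; ∃-syntax)
open import Data.Product.Function.NonDependent.Propositional using (_×-⇔_)
open import Data.Sum using (_⊎_; inj₁; inj₂; [_,_]′)
import Data.Sum as Sum
open import Data.Empty using (⊥; ⊥-elim)
open import Data.Unit using (tt)
open import Data.List using (List; []; _∷_; _++_)
open import Data.List.Relation.Unary.All as All using (All; _∷_)
import Data.List.Relation.Unary.All.Properties as All
open import Data.List.Relation.Unary.Any using (here; there)
open import Data.List.Membership.Propositional using (_∈_; _∉_)
open import Data.List.Membership.Propositional.Properties using (∈-++⁺ʳ)
open import Data.List.Relation.Unary.Unique.Propositional using (Unique)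
open import Data.List.Relation.Unary.Unique.Propositional.Properties using (Unique[x∷xs]⇒x∉xs)
open import Data.List.Relation.Binary.Permutation.Propositional using (_↭_; ↭⇒↭ₛ)
open import Data.List.Relation.Binary.Permutation.Propositional.Properties using (++-comm; All-resp-↭; ¬x∷xs↭[])
import Data.List.Relation.Binary.Permutation.Setoid.Properties as Permutationₛ
open import Data.List.Extrema.Nat using (min; argmin-sel; min≤⊤; min≤xs)
open import Function using (_∘_; id)
open import Function.Bundles using (_⇔_; mk⇔; Equivalence)
open import Function.Construct.Identity using (⇔-id)
open import Function.Construct.Symmetry using (⇔-sym)
open import Function.Construct.Composition using (_⇔-∘_)
open import Relation.Binary.Definitions using (tri<; tri≈; tri>)
open import Relation.Binary.PropositionalEquality
open import Relation.Nullary using (¬_; yes; no)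

-- Non-crossing forces every edge that crosses the boundary of a gap (the black
-- points between two white points) to produce a flawed pair.  So a flaw of
-- minimal width cuts its gap off from the point 0: meandering trees are
-- flawless.  Conversely, in a flawless diagram the black points under an edge
-- are connected, by induction on the length of the edge; and at the least
-- vertex of a cycle the two cycle edges would share their left end, while the
-- gap between their white points separates their right ends.

m≤n⇔2m<2n+1 : ∀ {m n} → m ≤ n ⇔ 2 * m < 2 * n + 1
m≤n⇔2m<2n+1 {m} {n} rewrite +-comm (2 * n) 1 =
  mk⇔ (s≤s ∘ *-monoʳ-≤ 2) (*-cancelˡ-≤ 2 ∘ ≤-pred)

m<n⇔2m+1<2n+1 : ∀ {m n} → m < n ⇔ 2 * m + 1 < 2 * n + 1
m<n⇔2m+1<2n+1 {m} {n} rewrite +-comm (2 * m) 1 | +-comm (2 * n) 1 =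
  mk⇔ (s≤s ∘ *-monoʳ-< 2) (*-cancelˡ-< 2 m n ∘ ≤-pred)

m<n⇔2m+1<2n : ∀ {m n} → m < n ⇔ 2 * m + 1 < 2 * n
m<n⇔2m+1<2n {m} {n} rewrite +-comm (2 * m) 1 =
  mk⇔ (subst (_≤ 2 * n) (*-suc 2 m) ∘ *-monoʳ-≤ 2) (*-cancelˡ-< 2 m n ∘ <-trans (n<1+n _))

m<n+1+k∧n≤o⇒m≤o+k : ∀ {m n o} k → m < n + suc k → n ≤ o → m ≤ o + k
m<n+1+k∧n≤o⇒m≤o+k {m} {n} k m<n+1+k n≤o =
  ≤-trans (≤-pred (subst (m <_) (+-suc n k) m<n+1+k)) (+-monoˡ-≤ k n≤o)

m≤n+1+k∧n<o⇒m≤o+k : ∀ {m n o} k → m ≤ n + suc k → n < o → m ≤ o + k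
m≤n+1+k∧n<o⇒m≤o+k {m} {n} k m≤n+1+k n<o =
  ≤-trans (subst (m ≤_) (+-suc n k) m≤n+1+k) (+-monoˡ-≤ k n<o)

toℕ-≤⇒<⊎≡ : ∀ {n} {i j : Fin n} → toℕ i ≤ toℕ j → toℕ i < toℕ j ⊎ i ≡ j
toℕ-≤⇒<⊎≡ = Sum.map₂ toℕ-injective ∘ m≤n⇒m<n∨m≡n

Unique-resp-↭ : ∀ {A : Set} {xs ys : List A} → xs ↭ ys → Unique xs → Unique ys
Unique-resp-↭ {A} = Permutationₛ.Unique-resp-↭ (setoid A) ∘ ↭⇒↭ₛ

minimum : (x : ℕ) (xs : List ℕ) → ∃[ a ] a ∈ x ∷ xs × All (a ≤_) (x ∷ xs)
minimum x xs = min x xs , [ here , there ]′ (argmin-sel id x xs) , min≤⊤ x xs ∷ min≤xs x xs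

unique-last-min⇒< : ∀ {a} xs → Unique (xs ++ a ∷ []) → All (a ≤_) xs → All (a <_) xs
unique-last-min⇒< {a} xs unique a≤xs =
  All.zipWith (λ (a≤x , a≢x) → ≤∧≢⇒< a≤x a≢x) (a≤xs , All.¬Any⇒All¬ xs a∉xs)
  where
  a∉xs : a ∉ xs
  a∉xs = Unique[x∷xs]⇒x∉xs (Unique-resp-↭ (++-comm xs (a ∷ [])) unique)

module _ {n : ℕ} (D : MeanderingDiagram n) where

  up<down : ∀ e → up D e < down D e
  up<down e = ≤-<-trans (up≤ D e) (<down D e)

  upper-nested⊎disjoint : ∀ {e f} → toℕ e < toℕ f → up D f ≤ up D e ⊎ toℕ e < up D f
  upper-nested⊎disjoint {e} {f} e<f with up D f ≤? up D e | up D f ≤? toℕ e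
  ... | yes uf≤ue | _        = inj₁ uf≤ue
  ... | no _      | no uf≰e  = inj₂ (≰⇒> uf≰e)
  ... | no uf≰ue  | yes uf≤e = ⊥-elim (upper-noncrossing D e f
        ( *-monoʳ-< 2 (≰⇒> uf≰ue)
        , Equivalence.to m≤n⇔2m<2n+1 uf≤e
        , Equivalence.to m<n⇔2m+1<2n+1 e<f))

  lower-disjoint⊎nested : ∀ {e f} → toℕ e < toℕ f → down D e ≤ toℕ f ⊎ down D f ≤ down D e
  lower-disjoint⊎nested {e} {f} e<f with down D e ≤? toℕ f | down D f ≤? down D e
  ... | yes de≤f | _         = inj₁ de≤f
  ... | no _     | yes df≤de = inj₂ df≤de
  ... | no de≰f  | no df≰de  = ⊥-elim (lower-noncrossing D e f
        ( Equivalence.to m<n⇔2m+1<2n+1 e<f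
        , Equivalence.to m<n⇔2m+1<2n (≰⇒> de≰f)
        , *-monoʳ-< 2 (≰⇒> df≰de)))

  -- A flawed pair in undoubled coordinates.
  Flaw : Fin n → Fin n → Set
  Flaw j i = up D i ≤ toℕ j × toℕ j < toℕ i × toℕ i < down D j

  Flawless : Set
  Flawless = ∀ j i → ¬ Flaw j i

  flaw⇔flawedPair : ∀ j i → Flaw j i ⇔ FlawedPair D j i
  flaw⇔flawedPair j i = m≤n⇔2m<2n+1 ×-⇔ m<n⇔2m+1<2n+1 ×-⇔ m<n⇔2m+1<2n

  flawless⇔¬hasFlawedPair : Flawless ⇔ (¬ HasFlawedPair D)
  flawless⇔¬hasFlawedPair = mk⇔
    (λ flawless (j , i , flawed) → flawless j i (Equivalence.from (flaw⇔flawedPair j i) flawed))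
    (λ ¬flawed j i flaw → ¬flawed (j , i , Equivalence.to (flaw⇔flawedPair j i) flaw))

  ¬Flaw⇒toℕ<up : ∀ {j i} → ¬ Flaw j i → toℕ j < toℕ i → toℕ i < down D j → toℕ j < up D i
  ¬Flaw⇒toℕ<up ¬flaw j<i i<dj = ≰⇒> (λ ui≤j → ¬flaw (ui≤j , j<i , i<dj))

  ¬Flaw⇒down≤toℕ : ∀ {j i} → ¬ Flaw j i → up D i ≤ toℕ j → toℕ j < toℕ i → down D j ≤ toℕ i
  ¬Flaw⇒down≤toℕ ¬flaw ui≤j j<i = ≮⇒≥ (λ i<dj → ¬flaw (ui≤j , j<i , i<dj))

  minimal-flaw-induction :
    (∀ j i → Flaw j i → (∀ f → toℕ j < toℕ f → toℕ f < toℕ i → ¬ Flaw j f × ¬ Flaw f i) → ⊥) →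
    Flawless
  minimal-flaw-induction minimal j i = narrower (toℕ i) j i (m≤n+m (toℕ i) (toℕ j))
    where
    narrower : ∀ k j i → toℕ i ≤ toℕ j + k → ¬ Flaw j i
    narrower zero j i i≤j+0 (_ , j<i , _) = <⇒≱ j<i (subst (toℕ i ≤_) (+-identityʳ _) i≤j+0)
    narrower (suc k) j i i≤j+1+k flaw = minimal j i flaw λ f j<f f<i →
        narrower k j f (m<n+1+k∧n≤o⇒m≤o+k k (<-≤-trans f<i i≤j+1+k) ≤-refl)
      , narrower k f i (m≤n+1+k∧n<o⇒m≤o+k k i≤j+1+k j<f)

  infixr 5 _++ʷ_

  _++ʷ_ : ∀ {u v w} → Walk D u v → Walk D v w → Walk D u w
  nil        ++ʷ q = q
  cons e j p ++ʷ q = cons e j (p ++ʷ q)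

  vertices : ∀ {u v} → Walk D u v → List ℕ
  vertices {u} p = u ∷ walkVertices D p

  walkVertices-++ʷ : ∀ {u v w} (p : Walk D u v) (q : Walk D v w) →
    walkVertices D (p ++ʷ q) ≡ walkVertices D p ++ walkVertices D q
  walkVertices-++ʷ nil          q = refl
  walkVertices-++ʷ (cons e j p) q = cong (_ ∷_) (walkVertices-++ʷ p q)

  walkEdges-++ʷ : ∀ {u v w} (p : Walk D u v) (q : Walk D v w) →
    walkEdges D (p ++ʷ q) ≡ walkEdges D p ++ walkEdges D q
  walkEdges-++ʷ nil          q = refl
  walkEdges-++ʷ (cons e j p) q = cong (e ∷_) (walkEdges-++ʷ p q)

  edge : ∀ e → Walk D (up D e) (down D e)
  edge e = cons e (inj₁ (refl , refl)) nil

  joins-sym : ∀ {e u v} → Joins D e u v → Joins D e v u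
  joins-sym (inj₁ (ue≡u , de≡v)) = inj₂ (de≡v , ue≡u)
  joins-sym (inj₂ (de≡u , ue≡v)) = inj₁ (ue≡v , de≡u)

  reverse : ∀ {u v} → Walk D u v → Walk D v u
  reverse nil          = nil
  reverse (cons e j p) = reverse p ++ʷ cons e (joins-sym j) nil

  joins-irrefl : ∀ {e u} → ¬ Joins D e u u
  joins-irrefl {e} (inj₁ (ue≡u , de≡u)) = <-irrefl (trans ue≡u (sym de≡u)) (up<down e)
  joins-irrefl {e} (inj₂ (de≡u , ue≡u)) = <-irrefl (trans ue≡u (sym de≡u)) (up<down e)

  joins-ordered : ∀ {e u v} → Joins D e u v → u < v → up D e ≡ u × down D e ≡ v
  joins-ordered     (inj₁ ends) _ = ends
  joins-ordered {e} (inj₂ (refl , refl)) u<v = ⊥-elim (<-asym u<v (up<down e))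

  All-vertices⇒target : ∀ {Q : ℕ → Set} {u v} (p : Walk D u v) → All Q (vertices p) → Q v
  All-vertices⇒target nil          (qu ∷ _) = qu
  All-vertices⇒target (cons e j p) (_ ∷ qs) = All-vertices⇒target p qs

  split : ∀ {u v a} (p : Walk D u v) → a ∈ walkVertices D p →
    Σ (Walk D u a) λ p₁ → Σ (Walk D a v) λ p₂ → p ≡ p₁ ++ʷ p₂
  split (cons e j p) (here refl) = cons e j nil , p , refl
  split (cons e j p) (there a∈p) with split p a∈p
  ... | p₁ , p₂ , refl = cons e j p₁ , p₂ , refl

  rotate : ∀ {u a} (p : Walk D u u) → a ∈ walkVertices D p →
    Σ (Walk D a a) λ r → walkVertices D p ↭ walkVertices D r × walkEdges D p ↭ walkEdges D r
  rotate p a∈p with split p a∈p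
  ... | p₁ , p₂ , refl =
      p₂ ++ʷ p₁
    , subst₂ _↭_ (sym (walkVertices-++ʷ p₁ p₂)) (sym (walkVertices-++ʷ p₂ p₁))
        (++-comm (walkVertices D p₁) (walkVertices D p₂))
    , subst₂ _↭_ (sym (walkEdges-++ʷ p₁ p₂)) (sym (walkEdges-++ʷ p₂ p₁))
        (++-comm (walkEdges D p₁) (walkEdges D p₂))

  lastStep : ∀ {u x v} e (j : Joins D e u x) (p : Walk D x v) →
    ∃[ y ] Σ (Walk D u y) λ q → ∃[ e′ ] Joins D e′ y v
      × walkVertices D (cons e j p) ≡ walkVertices D q ++ v ∷ []
      × walkEdges D (cons e j p) ≡ walkEdges D q ++ e′ ∷ []
  lastStep e j nil = _ , nil , e , j , refl , refl
  lastStep e j (cons e′ j′ p) with lastStep e′ j′ p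
  ... | y , q , e″ , j″ , vs , es = y , cons e j q , e″ , j″ , cong (_ ∷_) vs , cong (e ∷_) es

  walk-preserves : ∀ {H Q : ℕ → Set} →
    (∀ f → Q (up D f) → Q (down D f) → H (up D f) ⇔ H (down D f)) →
    ∀ {u v} (p : Walk D u v) → All Q (vertices p) → H u ⇔ H v
  walk-preserves {H} resp nil _ = ⇔-id (H _)
  walk-preserves resp (cons f (inj₁ (refl , refl)) p) (qu ∷ qs) =
    walk-preserves resp p qs ⇔-∘ resp f qu (All.head qs)
  walk-preserves resp (cons f (inj₂ (refl , refl)) p) (qu ∷ qs) =
    walk-preserves resp p qs ⇔-∘ ⇔-sym (resp f (All.head qs) qu)

  -- Black points lying between the white points j + 1/2 and i + 1/2.
  Between : Fin n → Fin n → ℕ → Set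
  Between j i v = toℕ j < v × v ≤ toℕ i

  gap-respected : ∀ j i f →
    (toℕ f ≤ toℕ j → down D f ≤ toℕ j ⊎ toℕ i < down D f) →
    (toℕ j < toℕ f → toℕ f < toℕ i → toℕ j < up D f × down D f ≤ toℕ i) →
    (toℕ i ≤ toℕ f → up D f ≤ toℕ j ⊎ toℕ i < up D f) →
    Between j i (up D f) ⇔ Between j i (down D f)
  gap-respected j i f leftward inside rightward with toℕ f ≤? toℕ j | toℕ i ≤? toℕ f
  ... | yes f≤j | _ = mk⇔
    (λ (j<uf , _) → ⊥-elim (<⇒≱ j<uf (≤-trans (up≤ D f) f≤j)))
    (λ (j<df , df≤i) → ⊥-elim ([ <⇒≱ j<df , (λ i<df → <⇒≱ i<df df≤i) ]′ (leftward f≤j)))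
  ... | no _ | yes i≤f = mk⇔
    (λ (j<uf , uf≤i) → ⊥-elim ([ <⇒≱ j<uf , (λ i<uf → <⇒≱ i<uf uf≤i) ]′ (rightward i≤f)))
    (λ (_ , df≤i) → ⊥-elim (<⇒≱ (≤-<-trans i≤f (<down D f)) df≤i))
  ... | no f≰j | no i≰f with inside (≰⇒> f≰j) (≰⇒> i≰f)
  ...   | j<uf , df≤i = mk⇔
    (λ _ → <-trans (≰⇒> f≰j) (<down D f) , df≤i)
    (λ _ → j<uf , ≤-trans (up≤ D f) (<⇒≤ (≰⇒> i≰f)))

  minimal-flaw-gap-respected : ∀ {j i} → Flaw j i →
    (∀ f → toℕ j < toℕ f → toℕ f < toℕ i → ¬ Flaw j f × ¬ Flaw f i) →
    ∀ f → Between j i (up D f) ⇔ Between j i (down D f)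
  minimal-flaw-gap-respected {j} {i} (ui≤j , j<i , i<dj) minimal f =
    gap-respected j i f leftward inside rightward
    where
    leftward : toℕ f ≤ toℕ j → down D f ≤ toℕ j ⊎ toℕ i < down D f
    leftward f≤j with toℕ-≤⇒<⊎≡ f≤j
    ... | inj₂ refl = inj₂ i<dj
    ... | inj₁ f<j  = Sum.map₂ (<-≤-trans i<dj) (lower-disjoint⊎nested f<j)
    inside : toℕ j < toℕ f → toℕ f < toℕ i → toℕ j < up D f × down D f ≤ toℕ i
    inside j<f f<i =
        ¬Flaw⇒toℕ<up (proj₁ (minimal f j<f f<i)) j<f (<-trans f<i i<dj)
      , ¬Flaw⇒down≤toℕ (proj₂ (minimal f j<f f<i)) (≤-trans ui≤j (<⇒≤ j<f)) f<i
    rightward : toℕ i ≤ toℕ f → up D f ≤ toℕ j ⊎ toℕ i < up D f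
    rightward i≤f with toℕ-≤⇒<⊎≡ i≤f
    ... | inj₂ refl = inj₁ ui≤j
    ... | inj₁ i<f  = Sum.map₁ (λ uf≤ui → ≤-trans uf≤ui ui≤j) (upper-nested⊎disjoint i<f)

  -- A minimal flaw (j, i) cuts off the black points of the gap from the point 0.
  connected⇒flawless : Connected D → Flawless
  connected⇒flawless connected = minimal-flaw-induction λ j i flaw@(_ , j<i , _) minimal →
    let walk = connected (suc (toℕ j)) 0 (≤-trans j<i (<⇒≤ (toℕ<n i))) z≤n
        gap  = walk-preserves {H = Between j i} (λ f _ _ → minimal-flaw-gap-respected flaw minimal f)
                 walk (All.universal (λ _ → tt) _)
    in  <⇒≱ (proj₁ (Equivalence.to gap (≤-refl , j<i))) z≤n

  StepsLinked : ℕ → ℕ → Set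
  StepsLinked lo hi = ∀ c → lo ≤ c → c < hi → Walk D c (suc c)

  stepsLinked⇒walk : ∀ {lo hi a b} → StepsLinked lo hi → lo ≤ a → a ≤ b → b ≤ hi → Walk D a b
  stepsLinked⇒walk {lo} {hi} {a} steps lo≤a a≤b = chain (≤⇒≤′ a≤b)
    where
    chain : ∀ {b} → a ≤′ b → b ≤ hi → Walk D a b
    chain ≤′-refl         _    = nil
    chain (≤′-step a≤′b) b<hi =
      chain a≤′b (<⇒≤ b<hi) ++ʷ steps _ (≤-trans lo≤a (≤′⇒≤ a≤′b)) b<hi

  stepsLinked-join : ∀ {lo m hi} →
    StepsLinked lo m → Walk D m (suc m) → StepsLinked (suc m) hi → StepsLinked lo hi
  stepsLinked-join {m = m} below step above c lo≤c c<hi with <-cmp c m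
  ... | tri< c<m _ _ = below c lo≤c c<m
  ... | tri≈ _ refl _ = step
  ... | tri> _ _ m<c = above c m<c c<hi

  edgeAt : ∀ {c} → c < n → ∃[ g ] toℕ g ≡ c
  edgeAt c<n = fromℕ< c<n , toℕ-fromℕ< c<n

  -- Induction on the length of the edge: the edges at the white points under
  -- the upper arc of f, and under its lower arc, are strictly shorter.
  span-linked : Flawless → ∀ k f → down D f ≤ up D f + k → StepsLinked (up D f) (down D f)
  span-linked flawless zero f short =
    ⊥-elim (<⇒≱ (up<down f) (subst (down D f ≤_) (+-identityʳ _) short))
  span-linked flawless (suc k) f short = stepsLinked-join underUpper middle underLower
    where
    underUpper : StepsLinked (up D f) (toℕ f)
    underUpper c uf≤c c<f with edgeAt (<-trans c<f (toℕ<n f))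
    ... | g , refl = span-linked flawless k g shorter (toℕ g) (up≤ D g) (<down D g)
      where
      uf≤ug : up D f ≤ up D g
      uf≤ug = [ id , (λ g<uf → ⊥-elim (<⇒≱ g<uf uf≤c)) ]′ (upper-nested⊎disjoint c<f)
      shorter : down D g ≤ up D g + k
      shorter = m<n+1+k∧n≤o⇒m≤o+k k
        (≤-<-trans (¬Flaw⇒down≤toℕ (flawless g f) uf≤c c<f) (<-≤-trans (<down D f) short)) uf≤ug
    underLower : StepsLinked (suc (toℕ f)) (down D f)
    underLower c f<c c<df with edgeAt (<-≤-trans c<df (down≤n D f))
    ... | g , refl = span-linked flawless k g shorter (toℕ g) (up≤ D g) (<down D g)
      where
      dg≤df : down D g ≤ down D f
      dg≤df = [ (λ df≤g → ⊥-elim (<⇒≱ c<df df≤g)) , id ]′ (lower-disjoint⊎nested f<c)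
      shorter : down D g ≤ up D g + k
      shorter = m≤n+1+k∧n<o⇒m≤o+k k (≤-trans dg≤df short)
        (≤-<-trans (up≤ D f) (¬Flaw⇒toℕ<up (flawless f g) f<c c<df))
    middle : Walk D (toℕ f) (suc (toℕ f))
    middle = reverse (stepsLinked⇒walk underUpper ≤-refl (up≤ D f) ≤-refl)
          ++ʷ edge f
          ++ʷ reverse (stepsLinked⇒walk underLower ≤-refl (<down D f) ≤-refl)

  flawless⇒stepsLinked : Flawless → StepsLinked 0 n
  flawless⇒stepsLinked flawless c _ c<n with edgeAt c<n
  ... | g , refl = span-linked flawless (down D g) g (m≤n+m _ _) (toℕ g) (up≤ D g) (<down D g)

  flawless⇒connected : Flawless → Connected D
  flawless⇒connected flawless u v u≤n v≤n with ≤-total u v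
  ... | inj₁ u≤v = stepsLinked⇒walk (flawless⇒stepsLinked flawless) z≤n u≤v v≤n
  ... | inj₂ v≤u = reverse (stepsLinked⇒walk (flawless⇒stepsLinked flawless) z≤n v≤u u≤n)

  sibling-gap-respected : Flawless → ∀ {e e′ a} → up D e ≡ a → up D e′ ≡ a → toℕ e < toℕ e′ →
    ∀ f → a < up D f → Between e e′ (up D f) ⇔ Between e e′ (down D f)
  sibling-gap-respected flawless {e} {e′} refl ue′≡ue e<e′ f ue<uf =
    gap-respected e e′ f leftward inside rightward
    where
    ue′<uf : up D e′ < up D f
    ue′<uf = subst (_< up D f) (sym ue′≡ue) ue<uf
    leftward : toℕ f ≤ toℕ e → down D f ≤ toℕ e ⊎ toℕ e′ < down D f
    leftward f≤e with toℕ-≤⇒<⊎≡ f≤e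
    ... | inj₂ refl = ⊥-elim (<-irrefl refl ue<uf)
    ... | inj₁ f<e  = inj₁ (¬Flaw⇒down≤toℕ (flawless f e) (≤-trans (<⇒≤ ue<uf) (up≤ D f)) f<e)
    inside : toℕ e < toℕ f → toℕ f < toℕ e′ → toℕ e < up D f × down D f ≤ toℕ e′
    inside e<f f<e′ =
        [ (λ uf≤ue → ⊥-elim (<⇒≱ ue<uf uf≤ue)) , id ]′ (upper-nested⊎disjoint e<f)
      , ¬Flaw⇒down≤toℕ (flawless f e′) (≤-trans (<⇒≤ ue′<uf) (up≤ D f)) f<e′
    rightward : toℕ e′ ≤ toℕ f → up D f ≤ toℕ e ⊎ toℕ e′ < up D f
    rightward e′≤f with toℕ-≤⇒<⊎≡ e′≤f
    ... | inj₂ refl = ⊥-elim (<-irrefl refl ue′<uf)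
    ... | inj₁ e′<f = [ (λ uf≤ue′ → ⊥-elim (<⇒≱ ue′<uf uf≤ue′)) , inj₂ ]′ (upper-nested⊎disjoint e′<f)

  sibling-gap-separates : Flawless → ∀ {e e′ a} → up D e ≡ a → up D e′ ≡ a → toℕ e < toℕ e′ →
    ¬ (Between e e′ (down D e) ⇔ Between e e′ (down D e′))
  sibling-gap-separates flawless {e} {e′} refl ue′≡ue e<e′ same =
    <⇒≱ (<down D e′) (proj₂ (Equivalence.to same (<down D e , de≤e′)))
    where
    de≤e′ : down D e ≤ toℕ e′
    de≤e′ = ¬Flaw⇒down≤toℕ (flawless e e′) (subst (_≤ toℕ e) (sym ue′≡ue) (up≤ D e)) e<e′

  siblings-unlinked : Flawless → ∀ {e₁ e₂ a x y} → e₁ ≢ e₂ → up D e₁ ≡ a → up D e₂ ≡ a →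
    down D e₁ ≡ x → down D e₂ ≡ y → (p : Walk D x y) → All (a <_) (vertices p) → ⊥
  siblings-unlinked flawless {e₁} {e₂} e₁≢e₂ u₁ u₂ refl refl p above with <-cmp (toℕ e₁) (toℕ e₂)
  ... | tri< e₁<e₂ _ _ = sibling-gap-separates flawless u₁ u₂ e₁<e₂
    (walk-preserves {H = Between e₁ e₂}
      (λ f a<uf _ → sibling-gap-respected flawless u₁ u₂ e₁<e₂ f a<uf) p above)
  ... | tri≈ _ e₁≡e₂ _ = e₁≢e₂ (toℕ-injective e₁≡e₂)
  ... | tri> _ _ e₂<e₁ = sibling-gap-separates flawless u₂ u₁ e₂<e₁
    (⇔-sym (walk-preserves {H = Between e₂ e₁}
      (λ f a<uf _ → sibling-gap-respected flawless u₂ u₁ e₂<e₁ f a<uf) p above))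

  ¬cycle-at-minimum : Flawless → ∀ {a x} e (j : Joins D e a x) (r : Walk D x a) →
    Unique (walkEdges D (cons e j r)) → Unique (walkVertices D (cons e j r)) →
    All (a ≤_) (walkVertices D (cons e j r)) → ⊥
  ¬cycle-at-minimum flawless e j nil _ _ _ = joins-irrefl j
  ¬cycle-at-minimum flawless {a} {x} e₁ j₁ (cons e j r) uniqueEdges uniqueVertices a≤ with lastStep e j r
  ... | y , q , e₂ , j₂ , vs , es =
    siblings-unlinked flawless e₁≢e₂ (proj₁ ends₁) (proj₁ ends₂) (proj₂ ends₁) (proj₂ ends₂) q above
    where
    above : All (a <_) (vertices q)
    above = unique-last-min⇒< (vertices q)
      (subst (λ vs′ → Unique (x ∷ vs′)) vs uniqueVertices)
      (All.++⁻ˡ (vertices q) (subst (λ vs′ → All (a ≤_) (x ∷ vs′)) vs a≤))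
    ends₁ : up D e₁ ≡ a × down D e₁ ≡ x
    ends₁ = joins-ordered j₁ (All.head above)
    ends₂ : up D e₂ ≡ a × down D e₂ ≡ y
    ends₂ = joins-ordered (joins-sym j₂) (All-vertices⇒target q above)
    e₁≢e₂ : e₁ ≢ e₂
    e₁≢e₂ e₁≡e₂ = Unique[x∷xs]⇒x∉xs (subst (λ es′ → Unique (e₁ ∷ es′)) es uniqueEdges)
      (∈-++⁺ʳ (walkEdges D q) (here e₁≡e₂))

  -- Rotate a cycle to start at its least vertex.
  flawless⇒acyclic : Flawless → ¬ HasCycle D
  flawless⇒acyclic flawless (_ , c@(cons {w = x} _ _ p) , uniqueEdges , uniqueVertices)
    with minimum x (walkVertices D p)
  ... | a , a∈ , a≤ with rotate c a∈
  ...   | nil , _ , es↭ = ¬x∷xs↭[] es↭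
  ...   | cons e j r , vs↭ , es↭ = ¬cycle-at-minimum flawless e j r
          (Unique-resp-↭ es↭ uniqueEdges) (Unique-resp-↭ vs↭ uniqueVertices) (All-resp-↭ vs↭ a≤)

lemma2p13 : (n : ℕ) (D : MeanderingDiagram n) →
    IsMeanderingTree D ⇔ (¬ HasFlawedPair D)
lemma2p13 n D = mk⇔
  (λ (connected , _) → Equivalence.to flawless⇔ (connected⇒flawless D connected))
  (λ ¬flawed → let flawless = Equivalence.from flawless⇔ ¬flawed in
    flawless⇒connected D flawless , flawless⇒acyclic D flawless)
  where
  flawless⇔ : Flawless D ⇔ (¬ HasFlawedPair D)
  flawless⇔ = flawless⇔¬hasFlawedPair D
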